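{- Let $d\ge0$ and $\mathbb{F}$ a field. For $f,f'\in VF_d(\mathbb{F})$ the following are equivalent: (i) $f\approx f'$; (ii) there exist nonzero $h_i,k_i\in\mathbb{F}$ ($0\le i\le d$) such that $f'(\lambda)=f(\lambda)\prod_{i=0}^s(h_ik_{t+i})$ for all $\lambda=(r,s,t)\in\Delta_d$.
   Context: $\Delta_d=\{(r,s,t)\in\mathbb{N}^3:r+s+t=d\}$, $VF_d(\mathbb{F})$ is the set of functions $\Delta_d\to\mathbb{F}\setminus\{0\}$. Matrices are indexed by $0,\dots,d$; $T[i,j]$ ($0\le i\le j\le d$) is the submatrix with rows $0,\dots,j-i$ and columns $i,\dots,j$; $T$ is very good if every $T[i,j]$ is invertible. $\mathcal{T}_d(\mathbb{F})$ is the set of very good upper triangular matrices, and $D:\mathcal{T}_d(\mathbb{F})\to VF_d(\mathbb{F})$, $D(T)((r,s,t))=\det T[t,d-r]$, is a bijection. On $\mathcal{T}_d(\mathbb{F})$, $T\sim T'$ iff $T'=HTK$ for invertible diagonal $H,K$. The relation $\approx$ on $VF_d(\mathbb{F})$ is defined by $D(T)\approx D(T')$ iff $T\sim T'$. -}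

module Defs where

open import Level using (Level; _⊔_) renaming (suc to lsuc)
open import Algebra.Bundles using (CommutativeRing)
open import Data.Nat using (ℕ; zero; suc; _∸_; _≤_; _<_) renaming (_+_ to _+ℕ_)
open import Data.Fin using (Fin; toℕ; punchIn) renaming (zero to fzero; suc to fsuc)
open import Data.Product using (Σ; ∃; _×_)
open import Relation.Binary.PropositionalEquality using (_≡_)
open import Relation.Nullary using (¬_)

record Field (c ℓ : Level) : Set (lsuc (c ⊔ ℓ)) where
  field
    commutativeRing : CommutativeRing c ℓ
  open CommutativeRing commutativeRing public
  field
    1≉0     : ¬ (1# ≈ 0#)
    inverse : ∀ x → ¬ (x ≈ 0#) → ∃ λ y → x * y ≈ 1#

record Pt (d : ℕ) : Set where
  constructor pt
  field
    r s t : ℕ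
    sum   : r +ℕ s +ℕ t ≡ d
open Pt public

module FieldDefs {c ℓ : Level} (F : Field c ℓ) where
  open Field F public

  NonZero : Carrier → Set ℓ
  NonZero x = ¬ (x ≈ 0#)

  ΣF : (n : ℕ) → (Fin n → Carrier) → Carrier
  ΣF zero    g = 0#
  ΣF (suc n) g = g fzero + ΣF n (λ j → g (fsuc j))

  Πℕ : (n : ℕ) → (ℕ → Carrier) → Carrier
  Πℕ zero    g = 1#
  Πℕ (suc n) g = g 0 * Πℕ n (λ i → g (suc i))

  sgn : ℕ → Carrier
  sgn zero    = 1#
  sgn (suc k) = - sgn k

  det : (n : ℕ) → (Fin n → Fin n → Carrier) → Carrier
  det zero    M = 1#
  det (suc n) M =
    ΣF (suc n) (λ j → sgn (toℕ j) * (M fzero j * det n (λ a b → M (fsuc a) (punchIn j b))))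

  -- Matrices indexed by 0..d; we store them as ℕ → ℕ → Carrier, and every
  -- condition below only inspects entries with indices ≤ d.
  Mat : Set c
  Mat = ℕ → ℕ → Carrier

  -- T[i,j]: rows 0..j-i, columns i..j  (size j-i+1)
  sub : Mat → (i j : ℕ) → Fin (suc (j ∸ i)) → Fin (suc (j ∸ i)) → Carrier
  sub T i j a b = T (toℕ a) (i +ℕ toℕ b)

  UpperTriangular : ℕ → Mat → Set ℓ
  UpperTriangular d T = ∀ i j → i ≤ d → j ≤ d → j < i → T i j ≈ 0#

  VeryGood : ℕ → Mat → Set ℓ
  VeryGood d T = ∀ i j → i ≤ j → j ≤ d → NonZero (det (suc (j ∸ i)) (sub T i j))

  InT : ℕ → Mat → Set ℓ
  InT d T = UpperTriangular d T × VeryGood d T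

  -- T ~ T' iff T' = H T K with H, K invertible diagonal
  _∼[_]_ : Mat → ℕ → Mat → Set (c ⊔ ℓ)
  T ∼[ d ] T' = Σ (ℕ → Carrier) λ h → Σ (ℕ → Carrier) λ k →
    (∀ i → i ≤ d → NonZero (h i)) × (∀ i → i ≤ d → NonZero (k i)) ×
    (∀ i j → i ≤ d → j ≤ d → T' i j ≈ h i * T i j * k j)

  record VF (d : ℕ) : Set (c ⊔ ℓ) where
    field
      fun     : Pt d → Carrier
      nonzero : ∀ p → NonZero (fun p)
  open VF public

  D[_]≐_ : ∀ {d} → Mat → VF d → Set ℓ
  D[_]≐_ {d} T f = ∀ (p : Pt d) → det (suc ((d ∸ r p) ∸ t p)) (sub T (t p) (d ∸ r p)) ≈ fun f p

  -- f ≈ f' iff f = D(T), f' = D(T') with T, T' ∈ 𝒯_d and T ∼ T'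
  -- (well defined since D is a bijection 𝒯_d → VF_d)
  _≈VF_ : ∀ {d} → VF d → VF d → Set (c ⊔ ℓ)
  _≈VF_ {d} f f' = Σ Mat λ T → Σ Mat λ T' →
    InT d T × InT d T' × D[ T ]≐ f × D[ T' ]≐ f' × T ∼[ d ] T'

{-# OPTIONS --safe #-}
-- (i) ⇒ (ii): D(HTK)(r,s,t) = det (HTK)[t, t+s] is det T[t, t+s] with its rows multiplied by
-- h₀ … h_s and its columns by k_t … k_{t+s}.
-- (ii) ⇒ (i): D is onto, so f = D(T) for some T ∈ 𝒯_d, and f' = D(HTK) by the same computation.
-- D is onto because det T[t, t+s] is affine in its bottom-right entry T(s, t+s), with slope the
-- minor for (r+1, s-1, t) (or 1 when s = 0), which is nonzero. Filling T one anti-diagonal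
-- a + c = N at a time, every other entry of that minor is already in place when T(s, t+s) is
-- reached, so the entry can be solved for.

module Submission where

open import Defs hiding (sum)
open import Level using (Level; _⊔_)
open import Data.Nat using (ℕ; zero; suc; _∸_; _≤_; _<_; s≤s; s≤s⁻¹; _≤?_; _≟_) renaming (_+_ to _+ℕ_)
import Data.Nat.Properties as ℕ
open import Data.Fin using (Fin; toℕ; punchIn; inject₁; fromℕ) renaming (zero to fzero; suc to fsuc)
open import Data.Fin.Properties using (toℕ-inject₁; toℕ-fromℕ; toℕ<n; inject₁ℕ<)
open import Data.Product using (Σ; _×_; _,_; proj₁; proj₂)
open import Data.Sum using (_⊎_; inj₁; inj₂)
open import Relation.Nullary using (¬_; yes; no; contradiction)
open import Relation.Nullary.Decidable using (_×-dec_)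
open import Relation.Binary.PropositionalEquality as ≡ using (_≡_; cong; cong₂)
open import Function.Bundles using (_⇔_; mk⇔)

punchIn-inject₁ : ∀ {n} (j : Fin (suc n)) (b : Fin n) → punchIn (inject₁ j) (inject₁ b) ≡ inject₁ (punchIn j b)
punchIn-inject₁ fzero    b        = ≡.refl
punchIn-inject₁ (fsuc j) fzero    = ≡.refl
punchIn-inject₁ (fsuc j) (fsuc b) = cong fsuc (punchIn-inject₁ j b)

punchIn-inject₁-fromℕ : ∀ {n} (j : Fin (suc n)) → punchIn (inject₁ j) (fromℕ n) ≡ fromℕ (suc n)
punchIn-inject₁-fromℕ         fzero    = ≡.refl
punchIn-inject₁-fromℕ {suc n} (fsuc j) = cong fsuc (punchIn-inject₁-fromℕ j)

punchIn-fromℕ : ∀ {n} (b : Fin n) → punchIn (fromℕ n) b ≡ inject₁ b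
punchIn-fromℕ {suc n} fzero    = ≡.refl
punchIn-fromℕ {suc n} (fsuc b) = cong fsuc (punchIn-fromℕ b)

module _ {d : ℕ} where

  pt-≡ : ∀ {r r′ s s′ t t′} {e : r +ℕ s +ℕ t ≡ d} {e′ : r′ +ℕ s′ +ℕ t′ ≡ d} →
    r ≡ r′ → s ≡ s′ → t ≡ t′ → pt r s t e ≡ pt r′ s′ t′ e′
  pt-≡ ≡.refl ≡.refl ≡.refl = cong (pt _ _ _) (ℕ.≡-irrelevant _ _)

  pointAt : ∀ s t → t +ℕ s ≤ d → Pt d
  pointAt s t t+s≤d = pt (d ∸ (t +ℕ s)) s t (begin
    d ∸ (t +ℕ s) +ℕ s +ℕ t    ≡⟨ ℕ.+-assoc (d ∸ (t +ℕ s)) s t ⟩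
    d ∸ (t +ℕ s) +ℕ (s +ℕ t)  ≡⟨ cong (d ∸ (t +ℕ s) +ℕ_) (ℕ.+-comm s t) ⟩
    d ∸ (t +ℕ s) +ℕ (t +ℕ s)  ≡⟨ ℕ.m∸n+n≡m t+s≤d ⟩
    d                          ∎)
    where open ≡.≡-Reasoning

  r+s+t≡r+[t+s] : ∀ r s t → r +ℕ s +ℕ t ≡ r +ℕ (t +ℕ s)
  r+s+t≡r+[t+s] r s t = ≡.trans (ℕ.+-assoc r s t) (cong (r +ℕ_) (ℕ.+-comm s t))

  lastColumn≤d : ∀ (p : Pt d) → t p +ℕ s p ≤ d
  lastColumn≤d (pt r s t ≡.refl) = ≡.subst (t +ℕ s ≤_) (≡.sym (r+s+t≡r+[t+s] r s t)) (ℕ.m≤n+m (t +ℕ s) r)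

  s≤d : ∀ (p : Pt d) → s p ≤ d
  s≤d p = ℕ.≤-trans (ℕ.m≤n+m (s p) (t p)) (lastColumn≤d p)

  d∸lastColumn≡r : ∀ (p : Pt d) → d ∸ (t p +ℕ s p) ≡ r p
  d∸lastColumn≡r (pt r s t ≡.refl) =
    ≡.trans (cong (_∸ (t +ℕ s)) (r+s+t≡r+[t+s] r s t)) (ℕ.m+n∸n≡m r (t +ℕ s))

  d∸r∸t≡s : ∀ (p : Pt d) → d ∸ r p ∸ t p ≡ s p
  d∸r∸t≡s (pt r s t ≡.refl) =
    ≡.trans (cong (λ m → m ∸ r ∸ t) (ℕ.+-assoc r s t))
      (≡.trans (cong (_∸ t) (ℕ.m+n∸m≡n r (s +ℕ t))) (ℕ.m+n∸n≡m s t))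

  pointAt-≡ : ∀ (p : Pt d) {s′ t′} (t′+s′≤d : t′ +ℕ s′ ≤ d) → s′ ≡ s p → t′ ≡ t p →
    pointAt s′ t′ t′+s′≤d ≡ p
  pointAt-≡ p _ ≡.refl ≡.refl = pt-≡ (d∸lastColumn≡r p) ≡.refl ≡.refl

entry≤corner : ∀ {a b n} t → a ≤ n → b ≤ n → a +ℕ (t +ℕ b) ≤ n +ℕ (t +ℕ n)
entry≤corner t a≤n b≤n = ℕ.+-mono-≤ a≤n (ℕ.+-monoʳ-≤ t b≤n)

entry<corner : ∀ {a b n} t → a ≤ n → b ≤ n → a < n ⊎ b < n → a +ℕ (t +ℕ b) < n +ℕ (t +ℕ n)
entry<corner t a≤n b≤n (inj₁ a<n) = ℕ.+-mono-<-≤ a<n (ℕ.+-monoʳ-≤ t b≤n)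
entry<corner t a≤n b≤n (inj₂ b<n) = ℕ.+-mono-≤-< a≤n (ℕ.+-monoʳ-< t b<n)

module _ {c ℓ : Level} (F : Field c ℓ) where
  open FieldDefs F
  open import Relation.Binary.Reasoning.Setoid setoid
  open import Algebra.Solver.Ring.NaturalCoefficients.Default commutativeSemiring
    using (solve; con; _:+_; _:*_; _:=_)
  open import Algebra.Properties.AbelianGroup +-abelianGroup using (xyx⁻¹≈y)
  open import Algebra.Properties.Semiring.Sum semiring
    using (sum; sum-cong-≋; sum-init-last; ∑-distrib-+; *-distribˡ-sum)
  open import Algebra.Properties.CommutativeMonoid.Sum *-commutativeMonoid
    using () renaming (sum to product; sum-remove to product-remove; ∑-distrib-+ to product-distrib-*)

  ΣF≡sum : ∀ n (g : Fin n → Carrier) → ΣF n g ≡ sum g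
  ΣF≡sum zero    g = ≡.refl
  ΣF≡sum (suc n) g = cong (g fzero +_) (ΣF≡sum n (λ j → g (fsuc j)))

  Πℕ≡product : ∀ n (g : ℕ → Carrier) → Πℕ n g ≡ product {n} (λ i → g (toℕ i))
  Πℕ≡product zero    g = ≡.refl
  Πℕ≡product (suc n) g = cong (g 0 *_) (Πℕ≡product n (λ i → g (suc i)))

  v*u≈1⇒x+[y-x]*u*v≈y : ∀ {u v} x y → v * u ≈ 1# → x + (y - x) * u * v ≈ y
  v*u≈1⇒x+[y-x]*u*v≈y {u} {v} x y vu≈1 = begin
    x + (y - x) * u * v    ≈⟨ +-congˡ (*-assoc (y - x) u v) ⟩
    x + (y - x) * (u * v)  ≈⟨ +-congˡ (*-congˡ (trans (*-comm u v) vu≈1)) ⟩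
    x + (y - x) * 1#       ≈⟨ +-congˡ (*-identityʳ (y - x)) ⟩
    x + (y - x)            ≈⟨ +-assoc x y (- x) ⟨
    x + y - x              ≈⟨ xyx⁻¹≈y x y ⟩
    y                      ∎

  Square : ℕ → Set c
  Square n = Fin n → Fin n → Carrier

  dropRow₀Col : ∀ {n} → Fin (suc n) → Square (suc n) → Square n
  dropRow₀Col j M a b = M (fsuc a) (punchIn j b)

  laplaceTerm : ∀ {n} → Square (suc n) → Fin (suc n) → Carrier
  laplaceTerm {n} M j = sgn (toℕ j) * (M fzero j * det n (dropRow₀Col j M))

  det-laplace : ∀ n (M : Square (suc n)) → det (suc n) M ≡ sum (laplaceTerm M)
  det-laplace n M = ΣF≡sum (suc n) (laplaceTerm M)

  det-cong : ∀ n {M M' : Square n} → (∀ a b → M a b ≈ M' a b) → det n M ≈ det n M'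
  det-cong zero    M≈M' = refl
  det-cong (suc n) {M} {M'} M≈M' = begin
    det (suc n) M         ≡⟨ det-laplace n M ⟩
    sum (laplaceTerm M)   ≈⟨ sum-cong-≋ term≈ ⟩
    sum (laplaceTerm M')  ≡⟨ det-laplace n M' ⟨
    det (suc n) M'        ∎
    where
    term≈ : ∀ j → laplaceTerm M j ≈ laplaceTerm M' j
    term≈ j = *-congˡ (*-cong (M≈M' fzero j) (det-cong n (λ a b → M≈M' (fsuc a) (punchIn j b))))

  det-scaleRows : ∀ n (h : Fin n → Carrier) (M : Square n) →
    det n (λ a b → h a * M a b) ≈ product h * det n M
  det-scaleRows zero    h M = sym (*-identityʳ 1#)
  det-scaleRows (suc n) h M = begin
    det (suc n) hM                           ≡⟨ det-laplace n hM ⟩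
    sum (laplaceTerm hM)                     ≈⟨ sum-cong-≋ pull ⟩
    sum (λ j → product h * laplaceTerm M j)  ≈⟨ *-distribˡ-sum (product h) (laplaceTerm M) ⟨
    product h * sum (laplaceTerm M)          ≡⟨ cong (product h *_) (det-laplace n M) ⟨
    product h * det (suc n) M                ∎
    where
    hM : Square (suc n)
    hM a b = h a * M a b
    pull : ∀ j → laplaceTerm hM j ≈ product h * laplaceTerm M j
    pull j = trans (*-congˡ (*-congˡ (det-scaleRows n (λ a → h (fsuc a)) (dropRow₀Col j M))))
      (solve 5 (λ σ h₀ m p D → σ :* ((h₀ :* m) :* (p :* D)) := (h₀ :* p) :* (σ :* (m :* D))) refl _ _ _ _ _)

  det-scaleCols : ∀ n (k : Fin n → Carrier) (M : Square n) →
    det n (λ a b → M a b * k b) ≈ product k * det n M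
  det-scaleCols zero    k M = sym (*-identityʳ 1#)
  det-scaleCols (suc n) k M = begin
    det (suc n) Mk                           ≡⟨ det-laplace n Mk ⟩
    sum (laplaceTerm Mk)                     ≈⟨ sum-cong-≋ pull ⟩
    sum (λ j → product k * laplaceTerm M j)  ≈⟨ *-distribˡ-sum (product k) (laplaceTerm M) ⟨
    product k * sum (laplaceTerm M)          ≡⟨ cong (product k *_) (det-laplace n M) ⟨
    product k * det (suc n) M                ∎
    where
    Mk : Square (suc n)
    Mk a b = M a b * k b
    pull : ∀ j → laplaceTerm Mk j ≈ product k * laplaceTerm M j
    pull j = begin
      laplaceTerm Mk j
        ≈⟨ *-congˡ (*-congˡ (det-scaleCols n (λ b → k (punchIn j b)) (dropRow₀Col j M))) ⟩
      sgn (toℕ j) * ((M fzero j * k j) * (product (λ b → k (punchIn j b)) * det n (dropRow₀Col j M)))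
        ≈⟨ solve 5 (λ σ m κ p D → σ :* ((m :* κ) :* (p :* D)) := (κ :* p) :* (σ :* (m :* D))) refl _ _ _ _ _ ⟩
      (k j * product (λ b → k (punchIn j b))) * laplaceTerm M j
        ≈⟨ *-congʳ (product-remove k) ⟨
      product k * laplaceTerm M j
        ∎

  topLeft : ∀ {n} → Square (suc n) → Square n
  topLeft M a b = M (inject₁ a) (inject₁ b)

  record CornerPerturbation {n} (M M' : Square (suc n)) (δ : Carrier) : Set ℓ where
    field
      rows   : ∀ (a : Fin n) b → M (inject₁ a) b ≈ M' (inject₁ a) b
      cols   : ∀ a (b : Fin n) → M a (inject₁ b) ≈ M' a (inject₁ b)
      corner : M (fromℕ n) (fromℕ n) ≈ M' (fromℕ n) (fromℕ n) + δ

  dropRow₀Col-perturbation : ∀ {n} {M M' : Square (suc (suc n))} {δ} → CornerPerturbation M M' δ →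
    ∀ j → CornerPerturbation (dropRow₀Col (inject₁ j) M) (dropRow₀Col (inject₁ j) M') δ
  dropRow₀Col-perturbation {n} {M} {M'} {δ} P j = record { rows = rows′ ; cols = cols′ ; corner = corner′ }
    where
    open CornerPerturbation P
    M₁ M₁′ : Square (suc n)
    M₁  = dropRow₀Col (inject₁ j) M
    M₁′ = dropRow₀Col (inject₁ j) M'
    rows′ : ∀ (a : Fin n) b → M₁ (inject₁ a) b ≈ M₁′ (inject₁ a) b
    rows′ a b = rows (fsuc a) (punchIn (inject₁ j) b)
    cols′ : ∀ a (b : Fin n) → M₁ a (inject₁ b) ≈ M₁′ a (inject₁ b)
    cols′ a b = ≡.subst (λ x → M (fsuc a) x ≈ M' (fsuc a) x) (≡.sym (punchIn-inject₁ j b)) (cols (fsuc a) (punchIn j b))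
    corner′ : M₁ (fromℕ n) (fromℕ n) ≈ M₁′ (fromℕ n) (fromℕ n) + δ
    corner′ = ≡.subst (λ x → M (fromℕ (suc n)) x ≈ M' (fromℕ (suc n)) x + δ) (≡.sym (punchIn-inject₁-fromℕ j)) corner

  det-perturbCorner : ∀ n {M M' : Square (suc n)} {δ} → CornerPerturbation M M' δ →
    det (suc n) M ≈ det (suc n) M' + δ * det n (topLeft M)

  laplaceTerm-perturbCorner : ∀ n {M M' : Square (suc (suc n))} {δ} → CornerPerturbation M M' δ → ∀ j →
    laplaceTerm M (inject₁ j) ≈ laplaceTerm M' (inject₁ j) + δ * laplaceTerm (topLeft M) j
  laplaceTerm-perturbCorner n {M} {M'} {δ} P j = begin
    σ * (m * det (suc n) (dropRow₀Col (inject₁ j) M))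
      ≈⟨ *-congˡ (*-congˡ (det-perturbCorner n (dropRow₀Col-perturbation P j))) ⟩
    σ * (m * (D′ + δ * D))
      ≈⟨ solve 5 (λ σ m D′ δ D → σ :* (m :* (D′ :+ δ :* D)) := σ :* (m :* D′) :+ δ :* (σ :* (m :* D)))
                 refl σ m D′ δ D ⟩
    σ * (m * D′) + δ * (σ * (m * D))
      ≈⟨ +-cong (*-congˡ (*-congʳ (CornerPerturbation.rows P fzero (inject₁ j))))
                (*-congˡ (*-cong σ≈ (*-congˡ D≈))) ⟩
    laplaceTerm M' (inject₁ j) + δ * laplaceTerm (topLeft M) j
      ∎
    where
    σ = sgn (toℕ (inject₁ j))
    m = M fzero (inject₁ j)
    D′ = det (suc n) (dropRow₀Col (inject₁ j) M')
    D = det n (topLeft (dropRow₀Col (inject₁ j) M))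
    σ≈ : σ ≈ sgn (toℕ j)
    σ≈ = reflexive (cong sgn (toℕ-inject₁ j))
    D≈ : D ≈ det n (dropRow₀Col j (topLeft M))
    D≈ = det-cong n (λ a b → reflexive (cong (M (fsuc (inject₁ a))) (punchIn-inject₁ j b)))

  det-perturbCorner zero {M} {M'} {δ} P = begin
    1# * (m * 1#) + 0#            ≈⟨ solve 1 (λ m → con 1 :* (m :* con 1) :+ con 0 := m) refl m ⟩
    m                             ≈⟨ CornerPerturbation.corner P ⟩
    m′ + δ                        ≈⟨ solve 2 (λ m′ δ → m′ :+ δ := con 1 :* (m′ :* con 1) :+ con 0 :+ δ :* con 1)
                                           refl m′ δ ⟩
    1# * (m′ * 1#) + 0# + δ * 1#  ∎
    where
    m = M fzero fzero
    m′ = M' fzero fzero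
  det-perturbCorner (suc n) {M} {M'} {δ} P = begin
    det (suc (suc n)) M
      ≡⟨ det-laplace (suc n) M ⟩
    sum (laplaceTerm M)
      ≈⟨ sum-init-last (laplaceTerm M) ⟩
    sum (λ j → laplaceTerm M (inject₁ j)) + laplaceTerm M last
      ≈⟨ +-cong (sum-cong-≋ (laplaceTerm-perturbCorner n P)) lastTerm≈ ⟩
    sum (λ j → laplaceTerm M' (inject₁ j) + δ * laplaceTerm (topLeft M) j) + laplaceTerm M' last
      ≈⟨ +-congʳ (trans (∑-distrib-+ (λ j → laplaceTerm M' (inject₁ j)) (λ j → δ * laplaceTerm (topLeft M) j))
                        (+-congˡ (sym (*-distribˡ-sum δ (laplaceTerm (topLeft M)))))) ⟩
    sum (λ j → laplaceTerm M' (inject₁ j)) + δ * sum (laplaceTerm (topLeft M)) + laplaceTerm M' last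
      ≈⟨ solve 3 (λ x y z → (x :+ y) :+ z := (x :+ z) :+ y) refl _ _ _ ⟩
    sum (λ j → laplaceTerm M' (inject₁ j)) + laplaceTerm M' last + δ * sum (laplaceTerm (topLeft M))
      ≈⟨ +-congʳ (sum-init-last (laplaceTerm M')) ⟨
    sum (laplaceTerm M') + δ * sum (laplaceTerm (topLeft M))
      ≡⟨ cong₂ (λ x y → x + δ * y) (det-laplace (suc n) M') (det-laplace n (topLeft M)) ⟨
    det (suc (suc n)) M' + δ * det (suc n) (topLeft M)
      ∎
    where
    open CornerPerturbation P
    last : Fin (suc (suc n))
    last = fromℕ (suc n)
    lastTerm≈ : laplaceTerm M last ≈ laplaceTerm M' last
    lastTerm≈ = *-congˡ (*-cong (rows fzero last) (det-cong (suc n) agree))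
      where
      agree : ∀ a b → dropRow₀Col last M a b ≈ dropRow₀Col last M' a b
      agree a b rewrite punchIn-fromℕ b = cols (fsuc a) b

  topMinor : Mat → ℕ → ℕ → Carrier
  topMinor T n t = det n (λ a b → T (toℕ a) (t +ℕ toℕ b))

  topMinor-cong : ∀ (A A' : Mat) n t → (∀ a b → a < n → b < n → A a (t +ℕ b) ≈ A' a (t +ℕ b)) →
    topMinor A n t ≈ topMinor A' n t
  topMinor-cong A A' n t agree = det-cong n (λ a b → agree (toℕ a) (toℕ b) (toℕ<n a) (toℕ<n b))

  rescale : (h k : ℕ → Carrier) → Mat → Mat
  rescale h k T i j = h i * T i j * k j

  rescale-upper : ∀ {d} h k T → UpperTriangular d T → UpperTriangular d (rescale h k T)
  rescale-upper h k T upper i j i≤d j≤d j<i =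
    trans (*-congʳ (trans (*-congˡ (upper i j i≤d j≤d j<i)) (zeroʳ (h i)))) (zeroˡ (k j))

  topMinor-rescale : ∀ (h k : ℕ → Carrier) (T : Mat) n t →
    topMinor (rescale h k T) n t ≈ Πℕ n (λ i → h i * k (t +ℕ i)) * topMinor T n t
  topMinor-rescale h k T n t = begin
    det n (λ a b → h (toℕ a) * T (toℕ a) (t +ℕ toℕ b) * kₜ b)
      ≈⟨ det-scaleCols n kₜ (λ a b → h (toℕ a) * T (toℕ a) (t +ℕ toℕ b)) ⟩
    product kₜ * det n (λ a b → hₜ a * T (toℕ a) (t +ℕ toℕ b))
      ≈⟨ *-congˡ (det-scaleRows n hₜ (λ a b → T (toℕ a) (t +ℕ toℕ b))) ⟩
    product kₜ * (product hₜ * topMinor T n t)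
      ≈⟨ solve 3 (λ x y z → x :* (y :* z) := (y :* x) :* z) refl _ _ _ ⟩
    product hₜ * product kₜ * topMinor T n t
      ≈⟨ *-congʳ (product-distrib-* hₜ kₜ) ⟨
    product (λ i → hₜ i * kₜ i) * topMinor T n t
      ≡⟨ cong (_* topMinor T n t) (Πℕ≡product n (λ i → h i * k (t +ℕ i))) ⟨
    Πℕ n (λ i → h i * k (t +ℕ i)) * topMinor T n t
      ∎
    where
    hₜ kₜ : Fin n → Carrier
    hₜ a = h (toℕ a)
    kₜ b = k (t +ℕ toℕ b)

  topMinor-perturbCorner : ∀ (A A' : Mat) n t δ →
    (∀ a b → a ≤ n → b ≤ n → a < n ⊎ b < n → A a (t +ℕ b) ≈ A' a (t +ℕ b)) →
    A n (t +ℕ n) ≈ A' n (t +ℕ n) + δ →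
    topMinor A (suc n) t ≈ topMinor A' (suc n) t + δ * topMinor A n t
  topMinor-perturbCorner A A' n t δ agree corner = begin
    topMinor A (suc n) t
      ≈⟨ det-perturbCorner n P ⟩
    topMinor A' (suc n) t + δ * det n (topLeft (λ a b → A (toℕ a) (t +ℕ toℕ b)))
      ≈⟨ +-congˡ (*-congˡ (det-cong n (λ a b → reflexive
           (cong₂ (λ x y → A x (t +ℕ y)) (toℕ-inject₁ a) (toℕ-inject₁ b))))) ⟩
    topMinor A' (suc n) t + δ * topMinor A n t
      ∎
    where
    P : CornerPerturbation (λ a b → A (toℕ a) (t +ℕ toℕ b)) (λ a b → A' (toℕ a) (t +ℕ toℕ b)) δ
    P = record
      { rows   = λ a b → agree _ _ (ℕ.<⇒≤ (inject₁ℕ< a)) (s≤s⁻¹ (toℕ<n b)) (inj₁ (inject₁ℕ< a))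
      ; cols   = λ a b → agree _ _ (s≤s⁻¹ (toℕ<n a)) (ℕ.<⇒≤ (inject₁ℕ< b)) (inj₂ (inject₁ℕ< b))
      ; corner = ≡.subst (λ x → A x (t +ℕ x) ≈ A' x (t +ℕ x) + δ) (≡.sym (toℕ-fromℕ n)) corner
      }

  D-as-topMinor : ∀ {d} (T : Mat) (p : Pt d) →
    det (suc (d ∸ r p ∸ t p)) (sub T (t p) (d ∸ r p)) ≡ topMinor T (suc (s p)) (t p)
  D-as-topMinor T p = cong (λ n → topMinor T (suc n) (t p)) (d∸r∸t≡s p)

  D≐⇒topMinor : ∀ {d} T (f : VF d) → D[ T ]≐ f → ∀ p → topMinor T (suc (s p)) (t p) ≈ fun f p
  D≐⇒topMinor T f DT p = trans (reflexive (≡.sym (D-as-topMinor T p))) (DT p)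

  topMinor⇒D≐ : ∀ {d} T (f : VF d) → (∀ p → topMinor T (suc (s p)) (t p) ≈ fun f p) → D[ T ]≐ f
  topMinor⇒D≐ T f minors p = trans (reflexive (D-as-topMinor T p)) (minors p)

  D≐⇒VeryGood : ∀ {d} T (f : VF d) → D[ T ]≐ f → VeryGood d T
  D≐⇒VeryGood {d} T f DT i j i≤j j≤d minor≈0 = nonzero f p (trans (sym (D≐⇒topMinor T f DT p)) minor≈0)
    where
    p : Pt d
    p = pointAt (j ∸ i) i (≡.subst (_≤ d) (≡.sym (ℕ.m+[n∸m]≡n i≤j)) j≤d)

  D≐-rescale : ∀ {d} T (f : VF d) (h k : ℕ → Carrier) → D[ T ]≐ f → ∀ p →
    topMinor (rescale h k T) (suc (s p)) (t p) ≈ fun f p * Πℕ (suc (s p)) (λ i → h i * k (t p +ℕ i))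
  D≐-rescale T f h k DT p = begin
    topMinor (rescale h k T) (suc (s p)) (t p)  ≈⟨ topMinor-rescale h k T (suc (s p)) (t p) ⟩
    Π * topMinor T (suc (s p)) (t p)            ≈⟨ *-congˡ (D≐⇒topMinor T f DT p) ⟩
    Π * fun f p                                 ≈⟨ *-comm Π (fun f p) ⟩
    fun f p * Π                                 ∎
    where
    Π = Πℕ (suc (s p)) (λ i → h i * k (t p +ℕ i))

  module Realisation {d : ℕ} (f : VF d) where

    -- T(s, t+s) is the bottom-right entry of the minor T[t, t+s] of p = (r, s, t).
    cornerSum : Pt d → ℕ
    cornerSum p = s p +ℕ (t p +ℕ s p)

    Realises : ℕ → Mat → Set ℓ
    Realises N T = ∀ p → cornerSum p < N → topMinor T (suc (s p)) (t p) ≈ fun f p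

    -- The minor of p with its last row and column removed is the minor of (r+1, s-1, t).
    pivot : Pt d → Carrier
    pivot (pt r zero    t _) = 1#
    pivot (pt r (suc s) t e) = fun f (pt (suc r) s t (≡.trans (cong (_+ℕ t) (≡.sym (ℕ.+-suc r s))) e))

    pivot-nonzero : ∀ p → NonZero (pivot p)
    pivot-nonzero (pt r zero    t _) = 1≉0
    pivot-nonzero (pt r (suc s) t _) = nonzero f _

    pivot⁻¹ : Pt d → Carrier
    pivot⁻¹ p = proj₁ (inverse (pivot p) (pivot-nonzero p))

    pivot-realised : ∀ {N} T → Realises N T → ∀ p → cornerSum p ≡ N → topMinor T (s p) (t p) ≈ pivot p
    pivot-realised T R (pt r zero    t _) _  = refl
    pivot-realised T R (pt r (suc s) t _) ≡N =
      R _ (≡.subst (s +ℕ (t +ℕ s) <_) ≡N (s≤s (ℕ.+-monoʳ-≤ s (ℕ.+-monoʳ-≤ t (ℕ.n≤1+n s)))))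

    module Step (N : ℕ) (T : Mat) where

      correction : Pt d → Carrier
      correction p = (fun f p - topMinor T (suc (s p)) (t p)) * pivot⁻¹ p

      T⁺ : Mat
      T⁺ a c with a ≤? c ×-dec c ≤? d ×-dec a +ℕ c ≟ N
      ... | yes (a≤c , c≤d , _) =
        T a c + correction (pointAt a (c ∸ a) (≡.subst (_≤ d) (≡.sym (ℕ.m∸n+n≡m a≤c)) c≤d))
      ... | no _                = T a c

      T⁺-unchanged : ∀ {a c} → ¬ (a ≤ c × c ≤ d × a +ℕ c ≡ N) → T⁺ a c ≡ T a c
      T⁺-unchanged {a} {c} ¬update with a ≤? c ×-dec c ≤? d ×-dec a +ℕ c ≟ N
      ... | yes update = contradiction update ¬update
      ... | no _       = ≡.refl

      T⁺-earlier : ∀ {a c} → a +ℕ c < N → T⁺ a c ≈ T a c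
      T⁺-earlier a+c<N = reflexive (T⁺-unchanged (λ (_ , _ , a+c≡N) → ℕ.<-irrefl a+c≡N a+c<N))

      T⁺-below : ∀ {a c} → c < a → T⁺ a c ≈ T a c
      T⁺-below c<a = reflexive (T⁺-unchanged (λ (a≤c , _) → ℕ.<⇒≱ c<a a≤c))

      T⁺-corner : ∀ p → cornerSum p ≡ N → T⁺ (s p) (t p +ℕ s p) ≈ T (s p) (t p +ℕ s p) + correction p
      T⁺-corner p ≡N with s p ≤? t p +ℕ s p ×-dec t p +ℕ s p ≤? d ×-dec cornerSum p ≟ N
      ... | yes _      = +-congˡ (reflexive (cong correction (pointAt-≡ p _ ≡.refl (ℕ.m+n∸n≡m (t p) (s p)))))
      ... | no ¬update = contradiction (ℕ.m≤n+m (s p) (t p) , lastColumn≤d p , ≡N) ¬update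

      realises⁺ : Realises N T → Realises (suc N) T⁺
      realises⁺ R p p<1+N with ℕ.m≤n⇒m<n∨m≡n (s≤s⁻¹ p<1+N)
      ... | inj₁ p<N = trans (topMinor-cong T⁺ T (suc (s p)) (t p) (λ a b a≤s b≤s →
              T⁺-earlier (ℕ.≤-<-trans (entry≤corner (t p) (s≤s⁻¹ a≤s) (s≤s⁻¹ b≤s)) p<N))) (R p p<N)
      ... | inj₂ p≡N = begin
        topMinor T⁺ (suc (s p)) (t p)
          ≈⟨ topMinor-perturbCorner T⁺ T (s p) (t p) (correction p)
               (λ a b a≤s b≤s off → T⁺-earlier (before (entry<corner (t p) a≤s b≤s off))) (T⁺-corner p p≡N) ⟩
        topMinor T (suc (s p)) (t p) + correction p * topMinor T⁺ (s p) (t p)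
          ≈⟨ +-congˡ (*-congˡ (trans topLeft-unchanged (pivot-realised T R p p≡N))) ⟩
        topMinor T (suc (s p)) (t p) + correction p * pivot p
          ≈⟨ v*u≈1⇒x+[y-x]*u*v≈y _ _ (proj₂ (inverse (pivot p) (pivot-nonzero p))) ⟩
        fun f p
          ∎
        where
        before : ∀ {n} → n < cornerSum p → n < N
        before = ≡.subst (_ <_) p≡N
        topLeft-unchanged : topMinor T⁺ (s p) (t p) ≈ topMinor T (s p) (t p)
        topLeft-unchanged = topMinor-cong T⁺ T (s p) (t p) (λ a b a<s b<s →
          T⁺-earlier (before (entry<corner (t p) (ℕ.<⇒≤ a<s) (ℕ.<⇒≤ b<s) (inj₁ a<s))))

    realisation : ∀ N → Σ Mat λ T → UpperTriangular d T × Realises N T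
    realisation zero = (λ _ _ → 0#) , (λ _ _ _ _ _ → refl) , (λ _ ())
    realisation (suc N) with realisation N
    ... | T , upper , R = T⁺ , upper⁺ , realises⁺ R
      where
      open Step N T
      upper⁺ : UpperTriangular d T⁺
      upper⁺ i j i≤d j≤d j<i = trans (T⁺-below j<i) (upper i j i≤d j≤d j<i)

    cornerSum≤d+d : ∀ p → cornerSum p ≤ d +ℕ d
    cornerSum≤d+d p = ℕ.+-mono-≤ (s≤d p) (lastColumn≤d p)

    D-surjective : Σ Mat λ T → InT d T × D[ T ]≐ f
    D-surjective with realisation (suc (d +ℕ d))
    ... | T , upper , R = T , (upper , D≐⇒VeryGood T f DT) , DT
      where
      DT : D[ T ]≐ f
      DT = topMinor⇒D≐ T f (λ p → R p (s≤s (cornerSum≤d+d p)))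

  Rescaled : ∀ {d} → VF d → VF d → Set (c ⊔ ℓ)
  Rescaled {d} f f' = Σ (ℕ → Carrier) λ h → Σ (ℕ → Carrier) λ k →
    (∀ i → i ≤ d → NonZero (h i)) × (∀ i → i ≤ d → NonZero (k i)) ×
    (∀ (p : Pt d) → fun f' p ≈ fun f p * Πℕ (suc (s p)) (λ i → h i * k (t p +ℕ i)))

  ≈VF⇒Rescaled : ∀ {d} (f f' : VF d) → f ≈VF f' → Rescaled f f'
  ≈VF⇒Rescaled {d} f f' (T , T' , _ , _ , DT , DT' , h , k , h≠0 , k≠0 , T'≈hTk) =
    h , k , h≠0 , k≠0 , λ p → begin
      fun f' p                                             ≈⟨ D≐⇒topMinor T' f' DT' p ⟨
      topMinor T' (suc (s p)) (t p)                        ≈⟨ topMinor-cong T' (rescale h k T) (suc (s p)) (t p) (agree p) ⟩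
      topMinor (rescale h k T) (suc (s p)) (t p)           ≈⟨ D≐-rescale T f h k DT p ⟩
      fun f p * Πℕ (suc (s p)) (λ i → h i * k (t p +ℕ i))  ∎
    where
    agree : ∀ p a b → a < suc (s p) → b < suc (s p) → T' a (t p +ℕ b) ≈ rescale h k T a (t p +ℕ b)
    agree p a b a≤s b≤s = T'≈hTk a (t p +ℕ b)
      (ℕ.≤-trans (s≤s⁻¹ a≤s) (s≤d p)) (ℕ.≤-trans (ℕ.+-monoʳ-≤ (t p) (s≤s⁻¹ b≤s)) (lastColumn≤d p))

  Rescaled⇒≈VF : ∀ {d} (f f' : VF d) → Rescaled f f' → f ≈VF f'
  Rescaled⇒≈VF {d} f f' (h , k , h≠0 , k≠0 , f'≈) with Realisation.D-surjective f
  ... | T , (upper , veryGood) , DT =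
    T , rescale h k T , (upper , veryGood) , (rescale-upper h k T upper , D≐⇒VeryGood (rescale h k T) f' DT') ,
    DT , DT' , h , k , h≠0 , k≠0 , (λ _ _ _ _ → refl)
    where
    DT' : D[ rescale h k T ]≐ f'
    DT' = topMinor⇒D≐ (rescale h k T) f' (λ p → trans (D≐-rescale T f h k DT p) (sym (f'≈ p)))

lemma8p8 : ∀ {c ℓ : Level} (F : Field c ℓ) (d : ℕ) →
    let open FieldDefs F in
    (f f' : VF d) →
    (f ≈VF f') ⇔
    (Σ (ℕ → Carrier) λ h → Σ (ℕ → Carrier) λ k →
      (∀ i → i ≤ d → NonZero (h i)) × (∀ i → i ≤ d → NonZero (k i)) ×
      (∀ (p : Pt d) → fun f' p ≈ fun f p * Πℕ (suc (s p)) (λ i → h i * k (t p +ℕ i))))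
lemma8p8 F d f f' = mk⇔ (≈VF⇒Rescaled F f f') (Rescaled⇒≈VF F f f')
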